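{- For every $n\ge0$, $$d_n^B(x,q)=\sum_{i=0}^n\sum_{j=0}^i\binom ni\binom ij d_{n-j}(x)\,q^i.$$
   Context: $B_n$ is the group of signed permutations of $\pm[n]$ ($\sigma(-i)=-\sigma(i)$). For $\sigma\in B_n$, $i\in[n]$ is an excedance if $\sigma(|\sigma(i)|)>\sigma(i)$ and a fixed point if $\sigma(i)=i$; $N(\sigma)=\#\{i:\sigma(i)<0\}$. $\mathcal D_n^B$ is the set of $\sigma\in B_n$ with no fixed points and $d_n^B(x,q)=\sum_{\sigma\in\mathcal D_n^B}x^{{\rm exc}(\sigma)}q^{N(\sigma)}$ ($d_0^B=1$). $d_n(x)=\sum x^{{\rm exc}(\pi)}$ over derangements $\pi\in\mathfrak S_n$ (no $\pi(i)=i$), where ${\rm exc}(\pi)=\#\{i:\pi(i)>i\}$, and $d_0(x)=1$. -}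

module Defs where

open import Data.Nat using (ℕ; zero; suc; _+_; _*_; _∸_; _<_; _<?_)
open import Data.Nat.Combinatorics using (_C_)
open import Data.Bool using (Bool; true; false)
open import Data.Fin using (Fin; toℕ)
import Data.Fin.Properties as FinP
open import Data.Integer as ℤ using (ℤ; +_; -[1+_])
import Data.Integer.Properties as ℤP
open import Data.List using (List; []; _∷_; map; concatMap; filter; length; upTo; allFin)
open import Data.Nat.ListAction using (sum)
open import Data.Vec using (Vec; lookup; toList)
import Data.Vec as V
open import Data.Product using (Σ; _×_; _,_; proj₁; proj₂)
open import Relation.Nullary using (¬_; Dec; yes; no; ¬?)
open import Relation.Nullary.Decidable using (_×-dec_)
open import Relation.Unary using (Decidable)
open import Relation.Binary.PropositionalEquality using (_≡_)
import Data.List.Relation.Unary.Unique.DecPropositional as UniqueDec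
open import Data.List.Relation.Unary.All using (All)
open import Data.List.Relation.Unary.All using (all?)

vecs : {A : Set} → List A → (k : ℕ) → List (Vec A k)
vecs xs zero    = V.[] ∷ []
vecs xs (suc k) = concatMap (λ x → map (x V.∷_) (vecs xs k)) xs

count : {A : Set} {P : A → Set} → Decidable P → List A → ℕ
count P? xs = length (filter P? xs)

-- Permutations of [n] = Fin n (i ∈ Fin n stands for toℕ i + 1 ∈ [n]),
-- encoded as the vector of values (π(1),…,π(n)); a vector is a
-- permutation iff its entries are pairwise distinct.

IsPerm : {n : ℕ} → Vec (Fin n) n → Set
IsPerm v = UniqueDec.Unique FinP._≟_ (toList v)

isPerm? : {n : ℕ} → Decidable (IsPerm {n})
isPerm? v = UniqueDec.unique? FinP._≟_ (toList v)

perms : (n : ℕ) → List (Vec (Fin n) n)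
perms n = filter isPerm? (vecs (allFin n) n)

IsDerangement : {n : ℕ} → Vec (Fin n) n → Set
IsDerangement {n} π = All (λ i → ¬ (lookup π i ≡ i)) (allFin n)

isDerangement? : {n : ℕ} → Decidable (IsDerangement {n})
isDerangement? {n} π = all? (λ i → ¬? (lookup π i FinP.≟ i)) (allFin n)

derangements : (n : ℕ) → List (Vec (Fin n) n)
derangements n = filter isDerangement? (perms n)

exc : {n : ℕ} → Vec (Fin n) n → ℕ
exc {n} π = count (λ i → toℕ i <? toℕ (lookup π i)) (allFin n)

-- Signed permutations B_n: a pair (π , s) with π ∈ 𝔖_n and a sign
-- vector s (true = negative).  σ(i) = - (π(i)) if s_i = true,
-- σ(i) = π(i) otherwise; σ(-i) = -σ(i).

SignedPerm : ℕ → Set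
SignedPerm n = Vec (Fin n) n × Vec Bool n

signedPerms : (n : ℕ) → List (SignedPerm n)
signedPerms n = concatMap (λ π → map (λ s → π , s) (vecs (true ∷ false ∷ []) n)) (perms n)

signedVal : {n : ℕ} → Bool → Fin n → ℤ
signedVal true  k = -[1+ toℕ k ]
signedVal false k = + suc (toℕ k)

sval : {n : ℕ} → SignedPerm n → Fin n → ℤ
sval (π , s) i = signedVal (lookup s i) (lookup π i)

absIdx : {n : ℕ} → SignedPerm n → Fin n → Fin n
absIdx (π , s) i = lookup π i

excB : {n : ℕ} → SignedPerm n → ℕ
excB {n} σ = count (λ i → sval σ i ℤ.<? sval σ (absIdx σ i)) (allFin n)

negB : {n : ℕ} → SignedPerm n → ℕ
negB {n} σ = count (λ i → sval σ i ℤ.<? + 0) (allFin n)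

IsDerangementB : {n : ℕ} → SignedPerm n → Set
IsDerangementB {n} σ = All (λ i → ¬ (sval σ i ≡ + suc (toℕ i))) (allFin n)

isDerangementB? : {n : ℕ} → Decidable (IsDerangementB {n})
isDerangementB? {n} σ = all? (λ i → ¬? (sval σ i ℤ.≟ + suc (toℕ i))) (allFin n)

derangementsB : (n : ℕ) → List (SignedPerm n)
derangementsB n = filter isDerangementB? (signedPerms n)

-- Polynomials in ℕ[x,q], represented by their coefficient function:
-- P a b = coefficient of x^a q^b.  Equality is coefficientwise.

Poly : Set
Poly = ℕ → ℕ → ℕ

_≋_ : Poly → Poly → Set
P ≋ Q = ∀ a b → P a b ≡ Q a b

mono : ℕ → ℕ → Poly
mono a b a' b' with a Data.Nat.≟ a' | b Data.Nat.≟ b'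
... | yes _ | yes _ = 1
... | _     | _     = 0

zeroP : Poly
zeroP _ _ = 0

_⊕_ : Poly → Poly → Poly
(P ⊕ Q) a b = P a b + Q a b

_⊙_ : ℕ → Poly → Poly
(c ⊙ P) a b = c * P a b

sumTo : ℕ → (ℕ → ℕ) → ℕ
sumTo n f = sum (map f (upTo (suc n)))

_⊗_ : Poly → Poly → Poly
(P ⊗ Q) a b = sumTo a (λ a' → sumTo b (λ b' → P a' b' * Q (a ∸ a') (b ∸ b')))

sumToP : ℕ → (ℕ → Poly) → Poly
sumToP n f = Data.List.foldr _⊕_ zeroP (map f (upTo (suc n)))

sumListP : {A : Set} → List A → (A → Poly) → Poly
sumListP xs f = Data.List.foldr _⊕_ zeroP (map f xs)

-- d_n(x) = Σ_{π derangement of [n]} x^{exc π}   (d_0 = 1 automatically)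
dPoly : ℕ → Poly
dPoly n = sumListP (derangements n) (λ π → mono (exc π) 0)

-- d^B_n(x,q) = Σ_{σ ∈ 𝒟^B_n} x^{exc σ} q^{N σ}   (d^B_0 = 1 automatically)
dBPoly : ℕ → Poly
dBPoly n = sumListP (derangementsB n) (λ σ → mono (excB σ) (negB σ))

qPow : ℕ → Poly
qPow i = mono 0 i

-- Split a signed permutation σ into its underlying permutation π and a sign vector t indexed by
-- values, so that σ(i) = r(π(i)) where r(v) = ±(v+1) is negative iff t(v). Substituting v = π(i),
-- the excedances of σ become the v with r(v) < r(π(v)), N(σ) becomes the number of negative signs,
-- and σ has no fixed point iff every fixed point of π carries a negative sign. So the coefficient of
-- x^a q^b in d^B_n is a sum, over the C(n,b) sign vectors with b negative entries, of the number of
-- permutations with a excedances relative to the injective ranking r whose fixed points lie in the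
-- set T of negative values.
--
-- That number depends only on k = |T| and equals Σ_j C(k,j) D(n-j,a), where D(m,a) counts the
-- derangements of [m] with a excedances. For k = 0, conjugating by the order isomorphism that ranks
-- the values of r turns r-excedances into ordinary ones. For k > 0 pick c ∈ T: the permutations
-- fixing c are the permutations of the remaining n-1 points with fixed points in T∖{c}, the others
-- are the permutations of all n points with fixed points in T∖{c}, and Pascal's rule closes the
-- induction. The coefficient of x^a q^b on the right-hand side is the same C(n,b) Σ_j C(b,j) D(n-j,a).

module Submission where

open import Defs
open import Data.Nat as ℕ using (ℕ; zero; suc; _+_; _*_; _∸_; _<_; _<?_; z≤n; s≤s)
open import Data.Nat.Combinatorics using (_C_; nCk+nC[k+1]≡[n+1]C[k+1]; k>n⇒nCk≡0)

open import Data.Bool as Bool using (Bool; true; false)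
open import Data.Bool.Properties using (not-¬; ¬-not)
open import Data.Empty using (⊥-elim)
open import Data.Fin using (Fin; zero; suc; punchIn; punchOut; toℕ; fromℕ<)
open import Data.Fin.Permutation as Perm using (Permutation′; _⟨$⟩ʳ_; _⟨$⟩ˡ_)
open import Data.Fin.Properties
  using (any?; all?; injective⇒≤; punchInᵢ≢i; punchIn-punchOut; punchOut-punchIn; punchIn-injective;
         punchOut-injective; punchOut-cong; suc-injective; toℕ-fromℕ<; toℕ-injective)
  renaming (_≟_ to _≟ᶠ_)
open import Data.Integer as ℤ using (ℤ)
import Data.Integer.Properties as ℤ
open import Data.List as List
  using (List; []; _∷_; _++_; map; concatMap; cartesianProductWith; filter; length; allFin; upTo; applyUpTo)
open import Data.List.Membership.Propositional using (_∈_)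
open import Data.List.Membership.Propositional.Properties
  using (∈-map⁺; ∈-map⁻; ∈-filter⁺; ∈-filter⁻; ∈-allFin; ∈-cartesianProductWith⁺)
open import Data.List.Membership.Propositional.Properties.WithK using (unique∧set⇒bag)
open import Data.List.Relation.Binary.BagAndSetEquality using (∼bag⇒↭)
import Data.List.Relation.Binary.Permutation.Propositional.Properties as ↭
open import Data.List.Relation.Unary.All as All using (All; []; _∷_)
import Data.List.Relation.Unary.All.Properties as All
open import Data.List.Relation.Unary.AllPairs using ([]; _∷_)
open import Data.List.Relation.Unary.Any using (here; there)
open import Data.List.Relation.Unary.Unique.Propositional using (Unique)
open import Data.List.Relation.Unary.Unique.Propositional.Properties using (filter⁺; allFin⁺; cartesianProductWith⁺)
open import Data.Nat.ListAction using (sum)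
open import Data.Nat.ListAction.Properties using (sum-↭)
import Data.Nat.Properties as ℕ
open import Data.Nat.Tactic.RingSolver using (solve-∀)
open import Data.Product using (∃; _×_; _,_; proj₁; proj₂)
open import Data.Sum using (_⊎_; inj₁; inj₂)
open import Data.Unit using (⊤; tt)
open import Data.Vec as Vec using (Vec; lookup; tabulate; toList)
open import Data.Vec.Functional using (updateAt)
open import Data.Vec.Functional.Properties using (updateAt-updates; updateAt-minimal)
import Data.Vec.Membership.Propositional as Vec
open import Data.Vec.Membership.Propositional.Properties using (∈-lookup; ∈-toList⁺; ∈-toList⁻)
import Data.Vec.Properties as Vec
open import Data.Vec.Properties using (lookup∘tabulate; tabulate∘lookup; tabulate-cong)
import Data.Vec.Relation.Unary.Any as Any
open import Data.Vec.Relation.Unary.Any.Properties using (lookup-index)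
open import Function using (_∘_; case_of_; _⇔_; mk⇔; Equivalence)
open import Function.Definitions using (Injective)
open import Relation.Binary.Definitions using (tri<; tri≈; tri>)
open import Relation.Binary.PropositionalEquality
open import Relation.Nullary using (¬_; Dec; yes; no)
open import Relation.Nullary.Decidable using (_→-dec_)
open import Relation.Unary using (Decidable)

open import Algebra.Properties.CommutativeSemigroup ℕ.+-commutativeSemigroup using (interchange; x∙yz≈y∙xz)
open import Algebra.Properties.CommutativeMonoid.Sum ℕ.+-0-commutativeMonoid
  using (sum-syntax; sum-cong-≗; sum-remove; sum-permute; sum-replicate-zero)
  renaming (sum to ∑)

private
  variable
    A B X : Set

𝟙 : {P : Set} → Dec P → ℕ
𝟙 (yes _) = 1
𝟙 (no _)  = 0

𝟙-cong : {P Q : Set} (p : Dec P) (q : Dec Q) → (P → Q) → (Q → P) → 𝟙 p ≡ 𝟙 q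
𝟙-cong (yes _) (yes _) _ _ = refl
𝟙-cong (yes x) (no ¬y) f _ = ⊥-elim (¬y (f x))
𝟙-cong (no ¬x) (yes y) _ g = ⊥-elim (¬x (g y))
𝟙-cong (no _)  (no _)  _ _ = refl

𝟙-yes : {P : Set} (p : Dec P) → P → 𝟙 p ≡ 1
𝟙-yes (yes _) _ = refl
𝟙-yes (no ¬x) x = ⊥-elim (¬x x)

𝟙-no : {P : Set} (p : Dec P) → ¬ P → 𝟙 p ≡ 0
𝟙-no (yes x) ¬x = ⊥-elim (¬x x)
𝟙-no (no _)  _  = refl

𝟙≤1 : {P : Set} (p : Dec P) → 𝟙 p ℕ.≤ 1
𝟙≤1 (yes _) = s≤s z≤n
𝟙≤1 (no _)  = z≤n

𝟙-mono : {P Q : Set} (p : Dec P) (q : Dec Q) → (P → Q) → 𝟙 p ℕ.≤ 𝟙 q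
𝟙-mono (yes x) (yes _) _ = s≤s z≤n
𝟙-mono (yes x) (no ¬y) f = ⊥-elim (¬y (f x))
𝟙-mono (no _)  _       _ = z≤n

sumOver : List A → (A → ℕ) → ℕ
sumOver xs w = sum (map w xs)

sumOver-++ : (xs ys : List A) (w : A → ℕ) → sumOver (xs ++ ys) w ≡ sumOver xs w + sumOver ys w
sumOver-++ []       ys w = refl
sumOver-++ (x ∷ xs) ys w = trans (cong (w x +_) (sumOver-++ xs ys w)) (sym (ℕ.+-assoc (w x) _ _))

sumOver-cong : (xs : List A) {u v : A → ℕ} → (∀ {x} → x ∈ xs → u x ≡ v x) → sumOver xs u ≡ sumOver xs v
sumOver-cong []       h = refl
sumOver-cong (x ∷ xs) h = cong₂ _+_ (h (here refl)) (sumOver-cong xs (h ∘ there))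

sumOver-cong-≗ : (xs : List A) {u v : A → ℕ} → (∀ x → u x ≡ v x) → sumOver xs u ≡ sumOver xs v
sumOver-cong-≗ xs h = sumOver-cong xs (λ {x} _ → h x)

sumOver-zero : (xs : List A) → sumOver xs (λ _ → 0) ≡ 0
sumOver-zero []       = refl
sumOver-zero (_ ∷ xs) = sumOver-zero xs

sumOver-+ : (xs : List A) (u v : A → ℕ) → sumOver xs (λ x → u x + v x) ≡ sumOver xs u + sumOver xs v
sumOver-+ []       u v = refl
sumOver-+ (x ∷ xs) u v = begin
  u x + v x + sumOver xs (λ x → u x + v x)  ≡⟨ cong (u x + v x +_) (sumOver-+ xs u v) ⟩
  u x + v x + (sumOver xs u + sumOver xs v) ≡⟨ interchange (u x) (v x) _ _ ⟩
  u x + sumOver xs u + (v x + sumOver xs v) ∎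
  where open ≡-Reasoning

sumOver-*ˡ : (xs : List A) (c : ℕ) (u : A → ℕ) → sumOver xs (λ x → c * u x) ≡ c * sumOver xs u
sumOver-*ˡ []       c u = sym (ℕ.*-zeroʳ c)
sumOver-*ˡ (x ∷ xs) c u =
  trans (cong (c * u x +_) (sumOver-*ˡ xs c u)) (sym (ℕ.*-distribˡ-+ c (u x) _))

sumOver-filter : {P : A → Set} (P? : Decidable P) (xs : List A) (w : A → ℕ) →
                 sumOver (filter P? xs) w ≡ sumOver xs (λ x → 𝟙 (P? x) * w x)
sumOver-filter P? []       w = refl
sumOver-filter P? (x ∷ xs) w with P? x
... | yes _ = cong₂ _+_ (sym (ℕ.+-identityʳ (w x))) (sumOver-filter P? xs w)
... | no _  = sumOver-filter P? xs w

length-filter : {P : A → Set} (P? : Decidable P) (xs : List A) →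
                length (filter P? xs) ≡ sumOver xs (λ x → 𝟙 (P? x))
length-filter P? []       = refl
length-filter P? (x ∷ xs) with P? x
... | yes _ = cong suc (length-filter P? xs)
... | no _  = length-filter P? xs

sumOver-map : (g : A → B) (xs : List A) (w : B → ℕ) → sumOver (map g xs) w ≡ sumOver xs (w ∘ g)
sumOver-map g []       w = refl
sumOver-map g (x ∷ xs) w = cong (w (g x) +_) (sumOver-map g xs w)

sumOver-concatMap : (f : A → List B) (xs : List A) (w : B → ℕ) →
                    sumOver (concatMap f xs) w ≡ sumOver xs (λ x → sumOver (f x) w)
sumOver-concatMap f []       w = refl
sumOver-concatMap f (x ∷ xs) w =
  trans (sumOver-++ (f x) (concatMap f xs) w) (cong (sumOver (f x) w +_) (sumOver-concatMap f xs w))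

sumOver-comm : (xs : List A) (ys : List B) (f : A → B → ℕ) →
               sumOver xs (λ x → sumOver ys (f x)) ≡ sumOver ys (λ y → sumOver xs (λ x → f x y))
sumOver-comm []       ys f = sym (sumOver-zero ys)
sumOver-comm (x ∷ xs) ys f =
  trans (cong (sumOver ys (f x) +_) (sumOver-comm xs ys f))
        (sym (sumOver-+ ys (f x) (λ y → sumOver xs (λ x → f x y))))

sumBelow : ℕ → (ℕ → ℕ) → ℕ
sumBelow zero    f = 0
sumBelow (suc n) f = f 0 + sumBelow n (f ∘ suc)

sumBelow-cong : (n : ℕ) {f g : ℕ → ℕ} → (∀ j → f j ≡ g j) → sumBelow n f ≡ sumBelow n g
sumBelow-cong zero    h = refl
sumBelow-cong (suc n) h = cong₂ _+_ (h 0) (sumBelow-cong n (h ∘ suc))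

sumBelow-+ : (n : ℕ) (f g : ℕ → ℕ) → sumBelow n (λ j → f j + g j) ≡ sumBelow n f + sumBelow n g
sumBelow-+ zero    f g = refl
sumBelow-+ (suc n) f g =
  trans (cong (f 0 + g 0 +_) (sumBelow-+ n (f ∘ suc) (g ∘ suc))) (interchange (f 0) (g 0) _ _)

sumBelow-snoc : (n : ℕ) (f : ℕ → ℕ) → sumBelow (suc n) f ≡ sumBelow n f + f n
sumBelow-snoc zero    f = ℕ.+-comm (f 0) 0
sumBelow-snoc (suc n) f = trans (cong (f 0 +_) (sumBelow-snoc n (f ∘ suc))) (sym (ℕ.+-assoc (f 0) _ _))

sumBelow-*ˡ : (n c : ℕ) (f : ℕ → ℕ) → sumBelow n (λ j → c * f j) ≡ c * sumBelow n f
sumBelow-*ˡ zero    c f = sym (ℕ.*-zeroʳ c)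
sumBelow-*ˡ (suc n) c f =
  trans (cong (c * f 0 +_) (sumBelow-*ˡ n c (f ∘ suc))) (sym (ℕ.*-distribˡ-+ c (f 0) _))

sumBelow-head : (n : ℕ) (f : ℕ → ℕ) → (∀ j → f (suc j) ≡ 0) → sumBelow (suc n) f ≡ f 0
sumBelow-head n f tail≡0 =
  trans (cong (f 0 +_) (trans (sumBelow-cong n tail≡0) (zeros n))) (ℕ.+-identityʳ (f 0))
  where
  zeros : ∀ n → sumBelow n (λ _ → 0) ≡ 0
  zeros zero    = refl
  zeros (suc n) = zeros n

sumBelow-last : (n : ℕ) (f : ℕ → ℕ) → (∀ j → j < n → f j ≡ 0) → sumBelow (suc n) f ≡ f n
sumBelow-last zero    f _      = ℕ.+-identityʳ (f 0)
sumBelow-last (suc n) f init≡0 =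
  trans (cong (_+ sumBelow (suc n) (f ∘ suc)) (init≡0 0 (s≤s z≤n)))
        (sumBelow-last n (f ∘ suc) (λ j j<n → init≡0 (suc j) (s≤s j<n)))

sumBelow-delta : (m b : ℕ) (h : ℕ → ℕ) → sumBelow m (λ i → 𝟙 (i ℕ.≟ b) * h i) ≡ 𝟙 (b <? m) * h b
sumBelow-delta zero    b       h = refl
sumBelow-delta (suc m) zero    h = trans (sumBelow-head m (λ i → 𝟙 (i ℕ.≟ 0) * h i) (λ _ → refl))
                                         (cong (_* h 0) (sym (𝟙-yes (0 <? suc m) (s≤s z≤n))))
sumBelow-delta (suc m) (suc b) h = begin
  sumBelow m (λ i → 𝟙 (suc i ℕ.≟ suc b) * h (suc i))
    ≡⟨ sumBelow-cong m (λ i → cong (_* h (suc i)) (𝟙-cong (suc i ℕ.≟ suc b) (i ℕ.≟ b) ℕ.suc-injective (cong suc))) ⟩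
  sumBelow m (λ i → 𝟙 (i ℕ.≟ b) * h (suc i))
    ≡⟨ sumBelow-delta m b (h ∘ suc) ⟩
  𝟙 (b <? m) * h (suc b)
    ≡⟨ cong (_* h (suc b)) (𝟙-cong (b <? m) (suc b <? suc m) s≤s ℕ.s≤s⁻¹) ⟩
  𝟙 (suc b <? suc m) * h (suc b)
    ∎
  where open ≡-Reasoning

sumOver-allFin : (n : ℕ) (w : Fin n → ℕ) → sumOver (allFin n) w ≡ ∑ w
sumOver-allFin n w = go n (λ i → i) w
  where
  go : (n : ℕ) (f : Fin n → A) (w : A → ℕ) → sumOver (List.tabulate f) w ≡ ∑ (w ∘ f)
  go zero    f w = refl
  go (suc n) f w = cong (w (f zero) +_) (go n (f ∘ suc) w)

∑-mono-≤ : {n : ℕ} {u v : Fin n → ℕ} → (∀ i → u i ℕ.≤ v i) → ∑ u ℕ.≤ ∑ v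
∑-mono-≤ {zero}  h = z≤n
∑-mono-≤ {suc n} h = ℕ.+-mono-≤ (h zero) (∑-mono-≤ (h ∘ suc))

∑-mono-< : {n : ℕ} {u v : Fin (suc n) → ℕ} (i : Fin (suc n)) →
           (∀ j → u j ℕ.≤ v j) → u i < v i → ∑ u < ∑ v
∑-mono-< {u = u} {v} i u≤v ui<vi = begin-strict
  ∑ u                              ≡⟨ sum-remove u ⟩
  u i + ∑ (u ∘ punchIn i)          <⟨ ℕ.+-mono-<-≤ ui<vi (∑-mono-≤ (u≤v ∘ punchIn i)) ⟩
  v i + ∑ (v ∘ punchIn i)          ≡⟨ sum-remove v ⟨
  ∑ v                              ∎
  where open ℕ.≤-Reasoning

∑≤n : {n : ℕ} {u : Fin n → ℕ} → (∀ i → u i ℕ.≤ 1) → ∑ u ℕ.≤ n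
∑≤n {zero}  h = z≤n
∑≤n {suc n} h = ℕ.+-mono-≤ (h zero) (∑≤n (h ∘ suc))

∑≡0⇒≡0 : {n : ℕ} (u : Fin n → ℕ) → ∑ u ≡ 0 → ∀ i → u i ≡ 0
∑≡0⇒≡0 {suc n} u ∑u≡0 i = ℕ.m+n≡0⇒m≡0 (u i) (trans (sym (sum-remove u)) ∑u≡0)

count-allFin : {n : ℕ} {P : Fin n → Set} (P? : Decidable P) → count P? (allFin n) ≡ ∑[ i < n ] 𝟙 (P? i)
count-allFin {n} P? = trans (length-filter P? (allFin n)) (sumOver-allFin n (λ i → 𝟙 (P? i)))

record IsEnumeration {A : Set} (P : A → Set) (xs : List A) : Set where
  field
    unique   : Unique xs
    sound    : ∀ {x} → x ∈ xs → P x
    complete : ∀ {x} → P x → x ∈ xs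
open IsEnumeration

IsListing : List A → Set
IsListing = IsEnumeration (λ _ → ⊤)

unique-map : (f : A → B) (xs : List A) → Unique xs →
             (∀ {x y} → x ∈ xs → y ∈ xs → f x ≡ f y → x ≡ y) → Unique (map f xs)
unique-map f []       _          _   = []
unique-map f (x ∷ xs) (x∉ ∷ xs!) inj =
  All.map⁺ (All.tabulate (λ y∈ fx≡fy → All.lookup x∉ y∈ (inj (here refl) (there y∈) fx≡fy)))
  ∷ unique-map f xs xs! (λ p q → inj (there p) (there q))

sumOver-bijection : {P : A → Set} {Q : B → Set} {xs : List A} {ys : List B} →
                    IsEnumeration P xs → IsEnumeration Q ys → (f : A → B) (g : B → A) →
                    (∀ {x} → P x → Q (f x)) → (∀ {y} → Q y → P (g y)) →
                    (∀ {x} → P x → g (f x) ≡ x) → (∀ {y} → Q y → f (g y) ≡ y) →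
                    (w : B → ℕ) → sumOver ys w ≡ sumOver xs (w ∘ f)
sumOver-bijection {xs = xs} {ys} ex ey f g f∈Q g∈P gf fg w =
  trans (sum-↭ (↭.map⁺ w ys↭fxs)) (sumOver-map f xs w)
  where
  f-injective-on-xs : ∀ {x y} → x ∈ xs → y ∈ xs → f x ≡ f y → x ≡ y
  f-injective-on-xs p q e = trans (sym (gf (sound ex p))) (trans (cong g e) (gf (sound ex q)))
  to : ∀ {y} → y ∈ ys → y ∈ map f xs
  to {y} y∈ = subst (_∈ map f xs) (fg (sound ey y∈)) (∈-map⁺ f (complete ex (g∈P (sound ey y∈))))
  from : ∀ {y} → y ∈ map f xs → y ∈ ys
  from y∈ with ∈-map⁻ f y∈
  ... | x , x∈ , refl = complete ey (f∈Q (sound ex x∈))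
  ys↭fxs = ∼bag⇒↭ (unique∧set⇒bag (unique ey) (unique-map f xs (unique ex) f-injective-on-xs) (mk⇔ to from))

filter-isEnumeration : {P Q : A → Set} (Q? : Decidable Q) {xs : List A} →
                       IsEnumeration P xs → IsEnumeration (λ x → P x × Q x) (filter Q? xs)
filter-isEnumeration Q? ex = record
  { unique   = filter⁺ Q? (unique ex)
  ; sound    = λ x∈ → let (p , q) = ∈-filter⁻ Q? x∈ in sound ex p , q
  ; complete = λ (p , q) → ∈-filter⁺ Q? (complete ex p) q
  }

isEnumeration-⇔ : {P Q : A → Set} {xs : List A} → IsEnumeration P xs →
                  (∀ {x} → P x → Q x) → (∀ {x} → Q x → P x) → IsEnumeration Q xs
isEnumeration-⇔ ex P⇒Q Q⇒P = record { unique = unique ex ; sound = P⇒Q ∘ sound ex ; complete = complete ex ∘ Q⇒P }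

allFin-isListing : (n : ℕ) → IsListing (allFin n)
allFin-isListing n = record { unique = allFin⁺ n ; sound = λ _ → tt ; complete = λ {i} _ → ∈-allFin i }

concatMap≡cartesianProductWith : (h : A → B → X) (xs : List A) (ys : List B) →
                                 concatMap (λ x → map (h x) ys) xs ≡ cartesianProductWith h xs ys
concatMap≡cartesianProductWith h []       ys = refl
concatMap≡cartesianProductWith h (x ∷ xs) ys = cong (map (h x) ys ++_) (concatMap≡cartesianProductWith h xs ys)

vecs-isListing : {xs : List A} → IsListing xs → (k : ℕ) → IsListing (vecs xs k)
vecs-isListing ex zero    = record { unique = [] ∷ [] ; sound = λ _ → tt ; complete = λ { {Vec.[]} _ → here refl } }
vecs-isListing {xs = xs} ex (suc k) =
  subst IsListing (sym (concatMap≡cartesianProductWith Vec._∷_ xs (vecs xs k))) (record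
    { unique   = cartesianProductWith⁺ Vec._∷_ Vec.∷-injective (unique ex) (unique (vecs-isListing ex k))
    ; sound    = λ _ → tt
    ; complete = λ { {x Vec.∷ v} _ → ∈-cartesianProductWith⁺ Vec._∷_ (complete ex tt) (complete (vecs-isListing ex k) tt) }
    })

-- Permutations

injective⇒surjective : {n : ℕ} {f : Fin n → Fin n} → Injective _≡_ _≡_ f → ∀ y → ∃ λ x → f x ≡ y
injective⇒surjective {suc m} {f} f-inj y with any? (λ x → f x ≟ᶠ y)
... | yes hit   = hit
... | no ¬hit = ⊥-elim (ℕ.1+n≰n (injective⇒≤ squeezed-injective))
  where
  avoids : ∀ x → y ≢ f x
  avoids x e = ¬hit (x , sym e)
  squeezed-injective : Injective _≡_ _≡_ (λ x → punchOut (avoids x))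
  squeezed-injective e = f-inj (punchOut-injective (avoids _) (avoids _) e)

injective⇒permutation : {n : ℕ} {f : Fin n → Fin n} → Injective _≡_ _≡_ f → Permutation′ n
injective⇒permutation {f = f} f-inj =
  Perm.permutation f (proj₁ ∘ surj) (proj₂ ∘ surj) (λ x → f-inj (proj₂ (surj (f x))))
  where
  surj = injective⇒surjective f-inj

lookup-ext : {n : ℕ} {u v : Vec A n} → (∀ i → lookup u i ≡ lookup v i) → u ≡ v
lookup-ext {u = u} {v} h = trans (sym (tabulate∘lookup u)) (trans (tabulate-cong h) (tabulate∘lookup v))

unique⇒lookup-injective : {n : ℕ} (v : Vec A n) → Unique (toList v) → Injective _≡_ _≡_ (lookup v)
unique⇒lookup-injective (x Vec.∷ v) (x∉ ∷ v!) {zero}  {zero}  e = refl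
unique⇒lookup-injective (x Vec.∷ v) (x∉ ∷ v!) {zero}  {suc j} e = ⊥-elim (All.lookup x∉ (∈-toList⁺ (∈-lookup j v)) e)
unique⇒lookup-injective (x Vec.∷ v) (x∉ ∷ v!) {suc i} {zero}  e = ⊥-elim (All.lookup x∉ (∈-toList⁺ (∈-lookup i v)) (sym e))
unique⇒lookup-injective (x Vec.∷ v) (x∉ ∷ v!) {suc i} {suc j} e = cong suc (unique⇒lookup-injective v v! e)

lookup-injective⇒unique : {n : ℕ} (v : Vec A n) → Injective _≡_ _≡_ (lookup v) → Unique (toList v)
lookup-injective⇒unique Vec.[]      _   = []
lookup-injective⇒unique (x Vec.∷ v) inj =
  All.tabulate (λ y∈ x≡y → head-unique (∈-toList⁻ y∈) x≡y)
  ∷ lookup-injective⇒unique v (suc-injective ∘ inj)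
  where
  head-unique : ∀ {y} → y Vec.∈ v → x ≢ y
  head-unique y∈ refl with () ← inj {zero} {suc (Any.index y∈)} (lookup-index y∈)

IsPermutation : {n : ℕ} → Vec (Fin n) n → Set
IsPermutation π = Injective _≡_ _≡_ (lookup π)

perms-isEnumeration : (n : ℕ) → IsEnumeration IsPermutation (perms n)
perms-isEnumeration n =
  isEnumeration-⇔ (filter-isEnumeration isPerm? (vecs-isListing (allFin-isListing n) n))
    (λ (_ , π!) → unique⇒lookup-injective _ π!) (λ π-inj → tt , lookup-injective⇒unique _ π-inj)

⟨$⟩ʳ-injective : {n : ℕ} (ρ : Permutation′ n) → Injective _≡_ _≡_ (ρ ⟨$⟩ʳ_)
⟨$⟩ʳ-injective ρ e = trans (sym (Perm.inverseˡ ρ)) (trans (cong (ρ ⟨$⟩ˡ_) e) (Perm.inverseˡ ρ))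

conjugate : {n : ℕ} → Permutation′ n → Vec (Fin n) n → Vec (Fin n) n
conjugate ρ π = tabulate (λ y → ρ ⟨$⟩ʳ lookup π (ρ ⟨$⟩ˡ y))

lookup-conjugate : {n : ℕ} (ρ : Permutation′ n) (π : Vec (Fin n) n) (x : Fin n) →
                   lookup (conjugate ρ π) (ρ ⟨$⟩ʳ x) ≡ ρ ⟨$⟩ʳ lookup π x
lookup-conjugate ρ π x =
  trans (lookup∘tabulate _ (ρ ⟨$⟩ʳ x)) (cong (λ y → ρ ⟨$⟩ʳ lookup π y) (Perm.inverseˡ ρ))

conjugate-isPermutation : {n : ℕ} (ρ : Permutation′ n) {π : Vec (Fin n) n} →
                          IsPermutation π → IsPermutation (conjugate ρ π)
conjugate-isPermutation ρ {π} π-inj {x} {y} e =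
  ⟨$⟩ˡ-injective (π-inj (⟨$⟩ʳ-injective ρ (trans (sym (lookup∘tabulate _ x)) (trans e (lookup∘tabulate _ y)))))
  where
  ⟨$⟩ˡ-injective : Injective _≡_ _≡_ (ρ ⟨$⟩ˡ_)
  ⟨$⟩ˡ-injective = ⟨$⟩ʳ-injective (Perm.flip ρ)

conjugate-flip : {n : ℕ} (ρ : Permutation′ n) (π : Vec (Fin n) n) → conjugate (Perm.flip ρ) (conjugate ρ π) ≡ π
conjugate-flip ρ π = lookup-ext (λ x → begin
  lookup (conjugate (Perm.flip ρ) (conjugate ρ π)) x   ≡⟨ lookup∘tabulate _ x ⟩
  ρ ⟨$⟩ˡ lookup (conjugate ρ π) (ρ ⟨$⟩ʳ x)             ≡⟨ cong (ρ ⟨$⟩ˡ_) (lookup-conjugate ρ π x) ⟩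
  ρ ⟨$⟩ˡ (ρ ⟨$⟩ʳ lookup π x)                           ≡⟨ Perm.inverseˡ ρ ⟩
  lookup π x                                           ∎)
  where open ≡-Reasoning

sumOver-perms-conjugate : (n : ℕ) (ρ : Permutation′ n) (w : Vec (Fin n) n → ℕ) →
                          sumOver (perms n) w ≡ sumOver (perms n) (w ∘ conjugate ρ)
sumOver-perms-conjugate n ρ =
  sumOver-bijection (perms-isEnumeration n) (perms-isEnumeration n) (conjugate ρ) (conjugate (Perm.flip ρ))
    (λ {π} → conjugate-isPermutation ρ {π}) (λ {π} → conjugate-isPermutation (Perm.flip ρ) {π})
    (λ {π} _ → conjugate-flip ρ π) (λ {π} _ → conjugate-flip (Perm.flip ρ) π)

punchIn-view : {m : ℕ} (c y : Fin (suc m)) → y ≡ c ⊎ ∃ λ x → y ≡ punchIn c x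
punchIn-view c y with c ≟ᶠ y
... | yes c≡y = inj₁ (sym c≡y)
... | no c≢y  = inj₂ (punchOut c≢y , sym (punchIn-punchOut c≢y))

squeeze : {m : ℕ} → Fin (suc m) → Fin m → Fin (suc m) → Fin m
squeeze c default y with c ≟ᶠ y
... | yes _   = default
... | no c≢y  = punchOut c≢y

punchIn-squeeze : {m : ℕ} (c : Fin (suc m)) (d : Fin m) {y : Fin (suc m)} → c ≢ y → punchIn c (squeeze c d y) ≡ y
punchIn-squeeze c d {y} c≢y with c ≟ᶠ y
... | yes c≡y = ⊥-elim (c≢y c≡y)
... | no c≢y  = punchIn-punchOut c≢y

squeeze-punchIn : {m : ℕ} (c : Fin (suc m)) (d x : Fin m) → squeeze c d (punchIn c x) ≡ x
squeeze-punchIn c d x = punchIn-injective c _ _ (punchIn-squeeze c d (punchInᵢ≢i c x ∘ sym))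

extendFixing : {m : ℕ} → Fin (suc m) → (Fin m → Fin m) → Fin (suc m) → Fin (suc m)
extendFixing c f y with c ≟ᶠ y
... | yes _  = c
... | no c≢y = punchIn c (f (punchOut c≢y))

extendFixing-c : {m : ℕ} (c : Fin (suc m)) (f : Fin m → Fin m) → extendFixing c f c ≡ c
extendFixing-c c f with c ≟ᶠ c
... | yes _   = refl
... | no c≢c  = ⊥-elim (c≢c refl)

extendFixing-punchIn : {m : ℕ} (c : Fin (suc m)) (f : Fin m → Fin m) (x : Fin m) →
                       extendFixing c f (punchIn c x) ≡ punchIn c (f x)
extendFixing-punchIn c f x with c ≟ᶠ punchIn c x
... | yes c≡c⁺ = ⊥-elim (punchInᵢ≢i c x (sym c≡c⁺))
... | no c≢c⁺  = cong (punchIn c ∘ f) (trans (punchOut-cong c refl) (punchOut-punchIn c))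

addFixedPoint : {m : ℕ} → Fin (suc m) → Vec (Fin m) m → Vec (Fin (suc m)) (suc m)
addFixedPoint c v = tabulate (extendFixing c (lookup v))

-- The default argument of squeeze is never used on a permutation fixing c.
deleteFixedPoint : {m : ℕ} → Fin (suc m) → Vec (Fin (suc m)) (suc m) → Vec (Fin m) m
deleteFixedPoint c π = tabulate (λ x → squeeze c x (lookup π (punchIn c x)))

module _ {m : ℕ} (c : Fin (suc m)) where

  lookup-deleteFixedPoint : (π : Vec (Fin (suc m)) (suc m)) (x : Fin m) →
                            lookup (deleteFixedPoint c π) x ≡ squeeze c x (lookup π (punchIn c x))
  lookup-deleteFixedPoint π = lookup∘tabulate (λ x → squeeze c x (lookup π (punchIn c x)))

  lookup-addFixedPoint-c : (v : Vec (Fin m) m) → lookup (addFixedPoint c v) c ≡ c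
  lookup-addFixedPoint-c v = trans (lookup∘tabulate (extendFixing c (lookup v)) c) (extendFixing-c c (lookup v))

  lookup-addFixedPoint-punchIn : (v : Vec (Fin m) m) (x : Fin m) →
                                 lookup (addFixedPoint c v) (punchIn c x) ≡ punchIn c (lookup v x)
  lookup-addFixedPoint-punchIn v x =
    trans (lookup∘tabulate (extendFixing c (lookup v)) (punchIn c x)) (extendFixing-punchIn c (lookup v) x)

  lookup-addFixedPoint-c≢punchIn : (v : Vec (Fin m) m) (x : Fin m) →
                                   lookup (addFixedPoint c v) c ≢ lookup (addFixedPoint c v) (punchIn c x)
  lookup-addFixedPoint-c≢punchIn v x e = punchInᵢ≢i c (lookup v x)
    (sym (trans (sym (lookup-addFixedPoint-c v)) (trans e (lookup-addFixedPoint-punchIn v x))))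

  addFixedPoint-isPermutation : {v : Vec (Fin m) m} → IsPermutation v → IsPermutation (addFixedPoint c v)
  addFixedPoint-isPermutation {v} v-inj {y} {z} e with punchIn-view c y | punchIn-view c z
  ... | inj₁ refl       | inj₁ refl       = refl
  ... | inj₁ refl       | inj₂ (x , refl) = ⊥-elim (lookup-addFixedPoint-c≢punchIn v x e)
  ... | inj₂ (x , refl) | inj₁ refl       = ⊥-elim (lookup-addFixedPoint-c≢punchIn v x (sym e))
  ... | inj₂ (x , refl) | inj₂ (x′ , refl) =
    cong (punchIn c) (v-inj (punchIn-injective c _ _ (trans (sym (lookup-addFixedPoint-punchIn v x))
                                                       (trans e (lookup-addFixedPoint-punchIn v x′)))))

  module _ {π : Vec (Fin (suc m)) (suc m)} (π-inj : IsPermutation π) (πc≡c : lookup π c ≡ c) where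

    punchIn-deleteFixedPoint : ∀ x → punchIn c (lookup (deleteFixedPoint c π) x) ≡ lookup π (punchIn c x)
    punchIn-deleteFixedPoint x = trans (cong (punchIn c) (lookup-deleteFixedPoint π x)) (punchIn-squeeze c x c≢π⁺x)
      where
      c≢π⁺x : c ≢ lookup π (punchIn c x)
      c≢π⁺x e = punchInᵢ≢i c x (π-inj (trans (sym e) (sym πc≡c)))

    deleteFixedPoint-isPermutation : IsPermutation (deleteFixedPoint c π)
    deleteFixedPoint-isPermutation {x} {y} e = punchIn-injective c x y (π-inj (begin
      lookup π (punchIn c x)                        ≡⟨ punchIn-deleteFixedPoint x ⟨
      punchIn c (lookup (deleteFixedPoint c π) x)   ≡⟨ cong (punchIn c) e ⟩
      punchIn c (lookup (deleteFixedPoint c π) y)   ≡⟨ punchIn-deleteFixedPoint y ⟩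
      lookup π (punchIn c y)                        ∎))
      where open ≡-Reasoning

    addFixedPoint-deleteFixedPoint : addFixedPoint c (deleteFixedPoint c π) ≡ π
    addFixedPoint-deleteFixedPoint = lookup-ext λ y → case punchIn-view c y of λ where
      (inj₁ refl)       → trans (lookup-addFixedPoint-c (deleteFixedPoint c π)) (sym πc≡c)
      (inj₂ (x , refl)) → trans (lookup-addFixedPoint-punchIn (deleteFixedPoint c π) x) (punchIn-deleteFixedPoint x)

  deleteFixedPoint-addFixedPoint : (v : Vec (Fin m) m) → deleteFixedPoint c (addFixedPoint c v) ≡ v
  deleteFixedPoint-addFixedPoint v = lookup-ext λ x →
    trans (lookup-deleteFixedPoint (addFixedPoint c v) x)
          (trans (cong (squeeze c x) (lookup-addFixedPoint-punchIn v x)) (squeeze-punchIn c x (lookup v x)))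

  sumOver-perms-fixing : (w : Vec (Fin (suc m)) (suc m) → ℕ) →
    sumOver (filter (λ π → lookup π c ≟ᶠ c) (perms (suc m))) w ≡ sumOver (perms m) (w ∘ addFixedPoint c)
  sumOver-perms-fixing =
    sumOver-bijection (perms-isEnumeration m) (filter-isEnumeration (λ π → lookup π c ≟ᶠ c) (perms-isEnumeration (suc m)))
      (addFixedPoint c) (deleteFixedPoint c)
      (λ {v} v-inj → addFixedPoint-isPermutation {v} v-inj , lookup-addFixedPoint-c v)
      (λ {π} (π-inj , πc≡c) → deleteFixedPoint-isPermutation {π} π-inj πc≡c)
      (λ {v} _ → deleteFixedPoint-addFixedPoint v)
      (λ {π} (π-inj , πc≡c) → addFixedPoint-deleteFixedPoint {π} π-inj πc≡c)

rank : {n : ℕ} → (Fin n → ℤ) → Fin n → ℕ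
rank {n} r x = ∑[ y < n ] 𝟙 (r y ℤ.<? r x)

rank<n : {n : ℕ} (r : Fin n → ℤ) (x : Fin n) → rank r x < n
rank<n {suc m} r x = begin-strict
  rank r x                        ≡⟨ sum-remove {i = x} (λ y → 𝟙 (r y ℤ.<? r x)) ⟩
  𝟙 (r x ℤ.<? r x) + ∑ below-x    ≡⟨ cong (_+ ∑ below-x) (𝟙-no (r x ℤ.<? r x) (ℤ.<-irrefl refl)) ⟩
  ∑ below-x                       <⟨ s≤s (∑≤n (λ y → 𝟙≤1 (r (punchIn x y) ℤ.<? r x))) ⟩
  suc m                           ∎
  where
  open ℕ.≤-Reasoning
  below-x : Fin m → ℕ
  below-x y = 𝟙 (r (punchIn x y) ℤ.<? r x)

rank-mono-< : {n : ℕ} (r : Fin n → ℤ) {x y : Fin n} → r x ℤ.< r y → rank r x < rank r y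
rank-mono-< {suc m} r {x} {y} rx<ry = ∑-mono-< x
  (λ z → 𝟙-mono (r z ℤ.<? r x) (r z ℤ.<? r y) (λ rz<rx → ℤ.<-trans rz<rx rx<ry))
  (subst₂ _<_ (sym (𝟙-no (r x ℤ.<? r x) (ℤ.<-irrefl refl))) (sym (𝟙-yes (r x ℤ.<? r y) rx<ry)) (s≤s z≤n))

rank-cancel-< : {n : ℕ} (r : Fin n → ℤ) → Injective _≡_ _≡_ r → {x y : Fin n} → rank r x < rank r y → r x ℤ.< r y
rank-cancel-< r r-inj {x} {y} rkx<rky with ℤ.<-cmp (r x) (r y)
... | tri< rx<ry _ _ = rx<ry
... | tri≈ _ rx≡ry _ rewrite r-inj rx≡ry = ⊥-elim (ℕ.<-irrefl refl rkx<rky)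
... | tri> _ _ ry<rx = ⊥-elim (ℕ.<-asym rkx<rky (rank-mono-< r ry<rx))

module _ {n : ℕ} (r : Fin n → ℤ) where

  rankFin : Fin n → Fin n
  rankFin x = fromℕ< (rank<n r x)

  rankFin-<⁺ : ∀ {x y} → r x ℤ.< r y → toℕ (rankFin x) < toℕ (rankFin y)
  rankFin-<⁺ rx<ry = subst₂ _<_ (sym (toℕ-fromℕ< _)) (sym (toℕ-fromℕ< _)) (rank-mono-< r rx<ry)

  module _ (r-inj : Injective _≡_ _≡_ r) where

    rankFin-<⁻ : ∀ {x y} → toℕ (rankFin x) < toℕ (rankFin y) → r x ℤ.< r y
    rankFin-<⁻ h = rank-cancel-< r r-inj (subst₂ _<_ (toℕ-fromℕ< _) (toℕ-fromℕ< _) h)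

    rankFin-injective : Injective _≡_ _≡_ rankFin
    rankFin-injective {x} {y} e with ℤ.<-cmp (r x) (r y)
    ... | tri< rx<ry _ _ = ⊥-elim (ℕ.<-irrefl (cong toℕ e) (rankFin-<⁺ rx<ry))
    ... | tri≈ _ rx≡ry _ = r-inj rx≡ry
    ... | tri> _ _ ry<rx = ⊥-elim (ℕ.<-irrefl (cong toℕ (sym e)) (rankFin-<⁺ ry<rx))

    rankPermutation : Permutation′ n
    rankPermutation = injective⇒permutation rankFin-injective

-- Permutations whose fixed points lie in a given set

excBy : {n : ℕ} → (Fin n → ℤ) → Vec (Fin n) n → ℕ
excBy {n} r π = ∑[ i < n ] 𝟙 (r i ℤ.<? r (lookup π i))

FixedPointsIn : {n : ℕ} → (Fin n → Bool) → Vec (Fin n) n → Set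
FixedPointsIn t π = ∀ i → lookup π i ≡ i → t i ≡ true

fixedPointsIn? : {n : ℕ} (t : Fin n → Bool) → Decidable (FixedPointsIn t)
fixedPointsIn? t π = all? (λ i → (lookup π i ≟ᶠ i) →-dec (t i Bool.≟ true))

permCount : {n : ℕ} → (Fin n → ℤ) → (Fin n → Bool) → ℕ → ℕ
permCount {n} r t a = sumOver (perms n) (λ π → 𝟙 (fixedPointsIn? t π) * 𝟙 (excBy r π ℕ.≟ a))

derangementCount : ℕ → ℕ → ℕ
derangementCount n a = sumOver (perms n) (λ π → 𝟙 (isDerangement? π) * 𝟙 (exc π ℕ.≟ a))

module _ {n : ℕ} (ρ : Permutation′ n) (π : Vec (Fin n) n) where

  conjugate-fixed⇒fixed : ∀ {y} → lookup (conjugate ρ π) y ≡ y → lookup π (ρ ⟨$⟩ˡ y) ≡ ρ ⟨$⟩ˡ y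
  conjugate-fixed⇒fixed {y} e =
    trans (sym (Perm.inverseˡ ρ)) (cong (ρ ⟨$⟩ˡ_) (trans (sym (lookup∘tabulate _ y)) e))

  fixed⇒conjugate-fixed : ∀ {x} → lookup π x ≡ x → lookup (conjugate ρ π) (ρ ⟨$⟩ʳ x) ≡ ρ ⟨$⟩ʳ x
  fixed⇒conjugate-fixed {x} e = trans (lookup-conjugate ρ π x) (cong (ρ ⟨$⟩ʳ_) e)

  exc-conjugate : exc (conjugate ρ π) ≡ ∑[ x < n ] 𝟙 (toℕ (ρ ⟨$⟩ʳ x) <? toℕ (ρ ⟨$⟩ʳ lookup π x))
  exc-conjugate = begin
    exc (conjugate ρ π)
      ≡⟨ count-allFin (λ y → toℕ y <? toℕ (lookup (conjugate ρ π) y)) ⟩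
    ∑[ y < n ] 𝟙 (toℕ y <? toℕ (lookup (conjugate ρ π) y))
      ≡⟨ sum-permute _ ρ ⟩
    ∑[ x < n ] 𝟙 (toℕ (ρ ⟨$⟩ʳ x) <? toℕ (lookup (conjugate ρ π) (ρ ⟨$⟩ʳ x)))
      ≡⟨ sum-cong-≗ (λ x → cong (λ z → 𝟙 (toℕ (ρ ⟨$⟩ʳ x) <? toℕ z)) (lookup-conjugate ρ π x)) ⟩
    ∑[ x < n ] 𝟙 (toℕ (ρ ⟨$⟩ʳ x) <? toℕ (ρ ⟨$⟩ʳ lookup π x))
      ∎
    where open ≡-Reasoning

permCount-withoutFixedPoints : {n : ℕ} (r : Fin n → ℤ) → Injective _≡_ _≡_ r → (t : Fin n → Bool) →
                               (∀ i → t i ≡ false) → ∀ a → permCount r t a ≡ derangementCount n a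
permCount-withoutFixedPoints {n} r r-inj t t≡false a = sym (begin
  derangementCount n a
    ≡⟨ sumOver-perms-conjugate n ρ (λ σ → 𝟙 (isDerangement? σ) * 𝟙 (exc σ ℕ.≟ a)) ⟩
  sumOver (perms n) (λ π → 𝟙 (isDerangement? (conjugate ρ π)) * 𝟙 (exc (conjugate ρ π) ℕ.≟ a))
    ≡⟨ sumOver-cong-≗ (perms n) (λ π → cong₂ _*_ (derangement⇔ π) (cong (λ e → 𝟙 (e ℕ.≟ a)) (exc≡excBy π))) ⟩
  permCount r t a
    ∎)
  where
  open ≡-Reasoning
  ρ = rankPermutation r r-inj
  derangement⇔ : ∀ π → 𝟙 (isDerangement? (conjugate ρ π)) ≡ 𝟙 (fixedPointsIn? t π)
  derangement⇔ π = 𝟙-cong (isDerangement? (conjugate ρ π)) (fixedPointsIn? t π)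
    (λ noFixed x πx≡x → ⊥-elim (All.tabulate⁻ noFixed (ρ ⟨$⟩ʳ x) (fixed⇒conjugate-fixed ρ π πx≡x)))
    (λ fixedIn → All.tabulate⁺ (λ y e → not-¬ refl (trans (sym (fixedIn _ (conjugate-fixed⇒fixed ρ π e))) (t≡false _))))
  exc≡excBy : ∀ π → exc (conjugate ρ π) ≡ excBy r π
  exc≡excBy π = trans (exc-conjugate ρ π)
    (sum-cong-≗ (λ x → 𝟙-cong (toℕ (ρ ⟨$⟩ʳ x) <? _) (r x ℤ.<? _) (rankFin-<⁻ r r-inj) (rankFin-<⁺ r)))

binomialDerangementSum : ℕ → ℕ → ℕ → ℕ
binomialDerangementSum k n a = sumBelow (suc k) (λ j → (k C j) * derangementCount (n ∸ j) a)

binomialDerangementSum-pascal : (k m a : ℕ) →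
  binomialDerangementSum k m a + binomialDerangementSum k (suc m) a ≡ binomialDerangementSum (suc k) (suc m) a
binomialDerangementSum-pascal k m a = begin
  S + (1 * D₀ + rest)                              ≡⟨ x∙yz≈y∙xz S (1 * D₀) rest ⟩
  1 * D₀ + (S + rest)                              ≡⟨ cong (1 * D₀ +_) split ⟨
  1 * D₀ + sumBelow (suc k) (λ j → (suc k C suc j) * D j) ∎
  where
  open ≡-Reasoning
  S = binomialDerangementSum k m a
  D : ℕ → ℕ
  D j = derangementCount (m ∸ j) a
  D₀ = derangementCount (suc m) a
  Dˢ : ℕ → ℕ
  Dˢ j = (k C suc j) * D j
  rest = sumBelow k Dˢ
  pascal : ∀ j → (suc k C suc j) * D j ≡ (k C j) * D j + (k C suc j) * D j
  pascal j = trans (cong (_* D j) (sym (nCk+nC[k+1]≡[n+1]C[k+1] k j))) (ℕ.*-distribʳ-+ (D j) (k C j) _)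
  split : sumBelow (suc k) (λ j → (suc k C suc j) * D j) ≡ S + rest
  split = begin
    sumBelow (suc k) (λ j → (suc k C suc j) * D j)             ≡⟨ sumBelow-cong (suc k) pascal ⟩
    sumBelow (suc k) (λ j → (k C j) * D j + (k C suc j) * D j) ≡⟨ sumBelow-+ (suc k) (λ j → (k C j) * D j) Dˢ ⟩
    S + sumBelow (suc k) Dˢ                                    ≡⟨ cong (S +_) (sumBelow-snoc k Dˢ) ⟩
    S + (rest + (k C suc k) * D k)                             ≡⟨ cong (λ c → S + (rest + c * D k)) (k>n⇒nCk≡0 (ℕ.n<1+n k)) ⟩
    S + (rest + 0)                                             ≡⟨ cong (S +_) (ℕ.+-identityʳ rest) ⟩
    S + rest                                                   ∎

trueCount : {n : ℕ} → (Fin n → Bool) → ℕ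
trueCount {n} t = ∑[ i < n ] 𝟙 (t i Bool.≟ true)

unmark : {n : ℕ} → Fin n → (Fin n → Bool) → Fin n → Bool
unmark c t = updateAt t c (λ _ → false)

module _ {m : ℕ} (c : Fin (suc m)) where

  𝟙-fixedPointsIn-addFixedPoint : (t : Fin (suc m) → Bool) → t c ≡ true → (v : Vec (Fin m) m) →
                                  𝟙 (fixedPointsIn? t (addFixedPoint c v)) ≡ 𝟙 (fixedPointsIn? (t ∘ punchIn c) v)
  𝟙-fixedPointsIn-addFixedPoint t tc v = 𝟙-cong (fixedPointsIn? t (addFixedPoint c v)) (fixedPointsIn? (t ∘ punchIn c) v)
    (λ fixedIn x vx≡x → fixedIn (punchIn c x) (trans (lookup-addFixedPoint-punchIn c v x) (cong (punchIn c) vx≡x)))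
    (λ fixedIn y e → case punchIn-view c y of λ where
      (inj₁ refl)       → tc
      (inj₂ (x , refl)) → fixedIn x (punchIn-injective c _ _ (trans (sym (lookup-addFixedPoint-punchIn c v x)) e)))

  excBy-addFixedPoint : (r : Fin (suc m) → ℤ) (v : Vec (Fin m) m) →
                        excBy r (addFixedPoint c v) ≡ excBy (r ∘ punchIn c) v
  excBy-addFixedPoint r v = begin
    excBy r π                                        ≡⟨ sum-remove {i = c} (λ i → 𝟙 (r i ℤ.<? r (lookup π i))) ⟩
    𝟙 (r c ℤ.<? r (lookup π c)) + ∑ excedance-off-c  ≡⟨ cong₂ _+_ c-is-no-excedance (sum-cong-≗ shifted) ⟩
    excBy (r ∘ punchIn c) v                          ∎
    where
    open ≡-Reasoning
    π = addFixedPoint c v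
    excedance-off-c : Fin m → ℕ
    excedance-off-c x = 𝟙 (r (punchIn c x) ℤ.<? r (lookup π (punchIn c x)))
    c-is-no-excedance : 𝟙 (r c ℤ.<? r (lookup π c)) ≡ 0
    c-is-no-excedance = 𝟙-no (r c ℤ.<? _) (ℤ.<-irrefl (cong r (sym (lookup-addFixedPoint-c c v))))
    shifted : ∀ x → excedance-off-c x ≡ 𝟙 (r (punchIn c x) ℤ.<? r (punchIn c (lookup v x)))
    shifted x = cong (λ y → 𝟙 (r (punchIn c x) ℤ.<? r y)) (lookup-addFixedPoint-punchIn c v x)

  𝟙-fixedPointsIn-split : (t : Fin (suc m) → Bool) → t c ≡ true → (π : Vec (Fin (suc m)) (suc m)) (w : ℕ) →
    𝟙 (fixedPointsIn? t π) * w ≡ 𝟙 (lookup π c ≟ᶠ c) * (𝟙 (fixedPointsIn? t π) * w) + 𝟙 (fixedPointsIn? (unmark c t) π) * w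
  𝟙-fixedPointsIn-split t tc π w with lookup π c ≟ᶠ c
  ... | yes πc≡c = sym (begin
    𝟙 (fixedPointsIn? t π) * w + 0 + 𝟙 (fixedPointsIn? (unmark c t) π) * w  ≡⟨ cong (λ u → _ + u * w) c-excluded ⟩
    𝟙 (fixedPointsIn? t π) * w + 0 + 0                                       ≡⟨ ℕ.+-identityʳ _ ⟩
    𝟙 (fixedPointsIn? t π) * w + 0                                           ≡⟨ ℕ.+-identityʳ _ ⟩
    𝟙 (fixedPointsIn? t π) * w                                               ∎)
    where
    open ≡-Reasoning
    c-excluded : 𝟙 (fixedPointsIn? (unmark c t) π) ≡ 0
    c-excluded = 𝟙-no (fixedPointsIn? _ π) (λ fixedIn → not-¬ refl (trans (sym (fixedIn c πc≡c)) (updateAt-updates c t)))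
  ... | no πc≢c = cong (_* w) (𝟙-cong (fixedPointsIn? t π) (fixedPointsIn? _ π)
    (λ fixedIn i πi≡i → trans (updateAt-minimal i c t (i≢c i πi≡i)) (fixedIn i πi≡i))
    (λ fixedIn i πi≡i → trans (sym (updateAt-minimal i c t (i≢c i πi≡i))) (fixedIn i πi≡i)))
    where
    i≢c : ∀ i → lookup π i ≡ i → i ≢ c
    i≢c i πi≡i refl = πc≢c πi≡i

  permCount-split : (r : Fin (suc m) → ℤ) (t : Fin (suc m) → Bool) → t c ≡ true → (a : ℕ) →
    permCount r t a ≡ permCount (r ∘ punchIn c) (t ∘ punchIn c) a + permCount r (unmark c t) a
  permCount-split r t tc a = begin
    permCount r t a
      ≡⟨ sumOver-cong-≗ (perms (suc m)) (λ π → 𝟙-fixedPointsIn-split t tc π (E π)) ⟩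
    sumOver (perms (suc m)) (λ π → F π + 𝟙 (fixedPointsIn? (unmark c t) π) * E π)
      ≡⟨ sumOver-+ (perms (suc m)) F _ ⟩
    sumOver (perms (suc m)) F + permCount r (unmark c t) a
      ≡⟨ cong (_+ permCount r (unmark c t) a) fixing-c ⟩
    permCount (r ∘ punchIn c) (t ∘ punchIn c) a + permCount r (unmark c t) a
      ∎
    where
    open ≡-Reasoning
    E F : Vec (Fin (suc m)) (suc m) → ℕ
    E π = 𝟙 (excBy r π ℕ.≟ a)
    F π = 𝟙 (lookup π c ≟ᶠ c) * (𝟙 (fixedPointsIn? t π) * E π)
    fixing-c : sumOver (perms (suc m)) F ≡ permCount (r ∘ punchIn c) (t ∘ punchIn c) a
    fixing-c = begin
      sumOver (perms (suc m)) F
        ≡⟨ sumOver-filter (λ π → lookup π c ≟ᶠ c) (perms (suc m)) _ ⟨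
      sumOver (filter (λ π → lookup π c ≟ᶠ c) (perms (suc m))) (λ π → 𝟙 (fixedPointsIn? t π) * E π)
        ≡⟨ sumOver-perms-fixing c _ ⟩
      sumOver (perms m) (λ v → 𝟙 (fixedPointsIn? t (addFixedPoint c v)) * E (addFixedPoint c v))
        ≡⟨ sumOver-cong-≗ (perms m) (λ v → cong₂ _*_ (𝟙-fixedPointsIn-addFixedPoint t tc v)
                                                    (cong (λ e → 𝟙 (e ℕ.≟ a)) (excBy-addFixedPoint r v))) ⟩
      permCount (r ∘ punchIn c) (t ∘ punchIn c) a
        ∎

module _ {n : ℕ} (t : Fin n → Bool) where

  trueCount≡0⇒false : trueCount t ≡ 0 → ∀ i → t i ≡ false
  trueCount≡0⇒false none i = ¬-not λ ti≡true →
    ℕ.1+n≢0 (trans (sym (𝟙-yes (t i Bool.≟ true) ti≡true)) (∑≡0⇒≡0 _ none i))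

  trueCount≢0⇒true : ∀ {k} → trueCount t ≡ suc k → ∃ λ c → t c ≡ true
  trueCount≢0⇒true count≡1+k with any? (λ i → t i Bool.≟ true)
  ... | yes hit = hit
  ... | no ¬hit = ⊥-elim (ℕ.1+n≢0 (trans (sym count≡1+k) (trans
        (sum-cong-≗ (λ i → 𝟙-no (t i Bool.≟ true) (λ ti≡true → ¬hit (i , ti≡true))))
        (sum-replicate-zero n))))

trueCount-punchIn : {m : ℕ} (t : Fin (suc m) → Bool) {c : Fin (suc m)} → t c ≡ true →
                    trueCount t ≡ suc (trueCount (t ∘ punchIn c))
trueCount-punchIn t {c} tc = trans (sum-remove {i = c} (λ i → 𝟙 (t i Bool.≟ true)))
                                   (cong (λ b → 𝟙 (b Bool.≟ true) + trueCount (t ∘ punchIn c)) tc)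

trueCount-unmark : {m : ℕ} (t : Fin (suc m) → Bool) (c : Fin (suc m)) → trueCount (unmark c t) ≡ trueCount (t ∘ punchIn c)
trueCount-unmark t c = trans (sum-remove {i = c} (λ i → 𝟙 (unmark c t i Bool.≟ true)))
  (cong₂ (λ b s → 𝟙 (b Bool.≟ true) + s) (updateAt-updates c t)
         (sum-cong-≗ (λ x → cong (λ b → 𝟙 (b Bool.≟ true)) (updateAt-minimal (punchIn c x) c t (punchInᵢ≢i c x)))))

permCount≡binomialDerangementSum : (k : ℕ) {n : ℕ} (r : Fin n → ℤ) → Injective _≡_ _≡_ r → (t : Fin n → Bool) →
                                   trueCount t ≡ k → ∀ a → permCount r t a ≡ binomialDerangementSum k n a
permCount≡binomialDerangementSum zero {n} r r-inj t none a =
  trans (permCount-withoutFixedPoints r r-inj t (trueCount≡0⇒false t none) a)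
        (sym (trans (ℕ.+-identityʳ _) (ℕ.*-identityˡ _)))
permCount≡binomialDerangementSum (suc k) {zero}  r r-inj t () a
permCount≡binomialDerangementSum (suc k) {suc m} r r-inj t count≡1+k a = begin
  permCount r t a
    ≡⟨ permCount-split c r t tc a ⟩
  permCount (r ∘ punchIn c) (t ∘ punchIn c) a + permCount r (unmark c t) a
    ≡⟨ cong₂ _+_ (permCount≡binomialDerangementSum k (r ∘ punchIn c) r⁺-inj (t ∘ punchIn c) count⁺ a)
                 (permCount≡binomialDerangementSum k r r-inj (unmark c t) count⁻ a) ⟩
  binomialDerangementSum k m a + binomialDerangementSum k (suc m) a
    ≡⟨ binomialDerangementSum-pascal k m a ⟩
  binomialDerangementSum (suc k) (suc m) a
    ∎
  where
  open ≡-Reasoning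
  c  = proj₁ (trueCount≢0⇒true t count≡1+k)
  tc = proj₂ (trueCount≢0⇒true t count≡1+k)
  r⁺-inj : Injective _≡_ _≡_ (r ∘ punchIn c)
  r⁺-inj = punchIn-injective c _ _ ∘ r-inj
  count⁺ : trueCount (t ∘ punchIn c) ≡ k
  count⁺ = ℕ.suc-injective (trans (sym (trueCount-punchIn t tc)) count≡1+k)
  count⁻ : trueCount (unmark c t) ≡ k
  count⁻ = trans (trueCount-unmark t c) count⁺

-- Signed permutations

signVectors : (n : ℕ) → List (Vec Bool n)
signVectors n = vecs (true ∷ false ∷ []) n

signVectors-isListing : (n : ℕ) → IsListing (signVectors n)
signVectors-isListing = vecs-isListing (record
  { unique   = ((λ ()) ∷ []) ∷ [] ∷ []
  ; sound    = λ _ → tt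
  ; complete = λ { {true} _ → here refl ; {false} _ → there (here refl) }
  })

signVectors-with-trueCount : (n b : ℕ) → sumOver (signVectors n) (λ s → 𝟙 (trueCount (lookup s) ℕ.≟ b)) ≡ n C b
signVectors-with-trueCount zero    zero    = refl
signVectors-with-trueCount zero    (suc b) = refl
signVectors-with-trueCount (suc n) b = begin
  sumOver (signVectors (suc n)) (withCount b)
    ≡⟨ sumOver-concatMap (λ x → map (x Vec.∷_) (signVectors n)) (true ∷ false ∷ []) (withCount b) ⟩
  sumOver (map (true Vec.∷_) (signVectors n)) (withCount b)
    + (sumOver (map (false Vec.∷_) (signVectors n)) (withCount b) + 0)
    ≡⟨ cong₂ _+_ (sumOver-map (true Vec.∷_) (signVectors n) (withCount b))
                 (trans (ℕ.+-identityʳ _) (sumOver-map (false Vec.∷_) (signVectors n) (withCount b))) ⟩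
  sumOver (signVectors n) (withCount⁺ b) + sumOver (signVectors n) (withCount b)
    ≡⟨ pascal b ⟩
  suc n C b
    ∎
  where
  open ≡-Reasoning
  withCount withCount⁺ : {n : ℕ} → ℕ → Vec Bool n → ℕ
  withCount  b s = 𝟙 (trueCount (lookup s) ℕ.≟ b)
  withCount⁺ b s = 𝟙 (suc (trueCount (lookup s)) ℕ.≟ b)
  pascal : ∀ b → sumOver (signVectors n) (withCount⁺ b) + sumOver (signVectors n) (withCount b) ≡ suc n C b
  pascal zero    = trans (cong (_+ sumOver (signVectors n) (withCount 0)) none-at-0) (signVectors-with-trueCount n 0)
    where
    none-at-0 : sumOver (signVectors n) (withCount⁺ 0) ≡ 0
    none-at-0 = trans (sumOver-cong-≗ (signVectors n) (λ s → 𝟙-no (suc (trueCount (lookup s)) ℕ.≟ 0) (λ ())))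
                      (sumOver-zero (signVectors n))
  pascal (suc b) =
    trans (cong₂ _+_ shift (signVectors-with-trueCount n (suc b))) (nCk+nC[k+1]≡[n+1]C[k+1] n b)
    where
    shift : sumOver (signVectors n) (withCount⁺ (suc b)) ≡ n C b
    shift = trans (sumOver-cong-≗ (signVectors n) (λ s → 𝟙-cong (suc (trueCount (lookup s)) ℕ.≟ suc b)
                                                                 (trueCount (lookup s) ℕ.≟ b) ℕ.suc-injective (cong suc)))
                  (signVectors-with-trueCount n b)

signedValue : {n : ℕ} → Vec Bool n → Fin n → ℤ
signedValue t v = signedVal (lookup t v) v

signedVal≡+⇒ : {n : ℕ} (b : Bool) (k i : Fin n) → signedVal b k ≡ ℤ.+ suc (toℕ i) → b ≡ false × k ≡ i
signedVal≡+⇒ false k i e = refl , toℕ-injective (ℕ.suc-injective (ℤ.+-injective e))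

signedVal<0⇔ : {n : ℕ} (b : Bool) (k : Fin n) → (signedVal b k ℤ.< ℤ.0ℤ) ⇔ (b ≡ true)
signedVal<0⇔ true  k = mk⇔ (λ _ → refl) (λ _ → ℤ.-<+)
signedVal<0⇔ false k = mk⇔ (λ { (ℤ.+<+ ()) }) (λ ())

signedValue-injective : {n : ℕ} (t : Vec Bool n) → Injective _≡_ _≡_ (signedValue t)
signedValue-injective t {x} {y} e with lookup t x | lookup t y
... | true  | true  = toℕ-injective (ℤ.-[1+-injective e)
... | false | false = toℕ-injective (ℕ.suc-injective (ℤ.+-injective e))
... | true  | false with () ← e
... | false | true  with () ← e

-- SignedPerm stores the sign of σ(i) at position i; here it is read off the value π(i) instead.
permuteSigns : {n : ℕ} → Vec (Fin n) n → Vec Bool n → Vec Bool n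
permuteSigns π t = tabulate (λ i → lookup t (lookup π i))

lookup-permuteSigns : {n : ℕ} (π : Vec (Fin n) n) (t : Vec Bool n) (i : Fin n) →
                      lookup (permuteSigns π t) i ≡ lookup t (lookup π i)
lookup-permuteSigns π t = lookup∘tabulate (λ i → lookup t (lookup π i))

sumOver-signVectors-permute : {n : ℕ} (π : Vec (Fin n) n) → IsPermutation π → (w : Vec Bool n → ℕ) →
                              sumOver (signVectors n) w ≡ sumOver (signVectors n) (w ∘ permuteSigns π)
sumOver-signVectors-permute {n} π π-inj =
  sumOver-bijection (signVectors-isListing n) (signVectors-isListing n) (permuteSigns π) (permuteSigns π⁻¹)
    (λ _ → tt) (λ _ → tt)
    (λ {t} _ → cancel π π⁻¹ (λ i → trans (cong (lookup π) (lookup∘tabulate (ρ ⟨$⟩ˡ_) i)) (Perm.inverseʳ ρ)) t)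
    (λ {s} _ → cancel π⁻¹ π (λ i → trans (lookup∘tabulate (ρ ⟨$⟩ˡ_) (lookup π i)) (Perm.inverseˡ ρ)) s)
  where
  ρ = injective⇒permutation π-inj
  π⁻¹ = tabulate (ρ ⟨$⟩ˡ_)
  cancel : (α β : Vec (Fin n) n) → (∀ i → lookup α (lookup β i) ≡ i) →
           ∀ t → permuteSigns β (permuteSigns α t) ≡ t
  cancel α β αβ≡id t = lookup-ext λ i →
    trans (lookup-permuteSigns β (permuteSigns α t) i)
          (trans (lookup-permuteSigns α t (lookup β i)) (cong (lookup t) (αβ≡id i)))

module _ {n : ℕ} (π : Vec (Fin n) n) (t : Vec Bool n) where

  private
    σ : SignedPerm n
    σ = π , permuteSigns π t

  sval-permuteSigns : ∀ i → sval σ i ≡ signedValue t (lookup π i)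
  sval-permuteSigns i = cong (λ b → signedVal b (lookup π i)) (lookup-permuteSigns π t i)

  𝟙-isDerangementB-permuteSigns : 𝟙 (isDerangementB? σ) ≡ 𝟙 (fixedPointsIn? (lookup t) π)
  𝟙-isDerangementB-permuteSigns = 𝟙-cong (isDerangementB? σ) (fixedPointsIn? (lookup t) π) ⇒fixedIn ⇐fixedIn
    where
    ⇒fixedIn : IsDerangementB σ → FixedPointsIn (lookup t) π
    ⇒fixedIn noFixed x πx≡x with lookup t x in tx
    ... | true  = refl
    ... | false = ⊥-elim (All.tabulate⁻ noFixed x (begin
      sval σ x                     ≡⟨ sval-permuteSigns x ⟩
      signedValue t (lookup π x)   ≡⟨ cong (signedValue t) πx≡x ⟩
      signedVal (lookup t x) x     ≡⟨ cong (λ b → signedVal b x) tx ⟩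
      signedVal false x            ∎))
      where open ≡-Reasoning
    ⇐fixedIn : FixedPointsIn (lookup t) π → IsDerangementB σ
    ⇐fixedIn fixedIn = All.tabulate⁺ λ i σi≡i →
      let (positive , πi≡i) = signedVal≡+⇒ _ (lookup π i) i (trans (sym (sval-permuteSigns i)) σi≡i)
      in not-¬ refl (trans (sym (fixedIn i πi≡i)) (trans (cong (lookup t) (sym πi≡i)) positive))

  module _ (π-inj : IsPermutation π) where

    private
      ρ : Permutation′ n
      ρ = injective⇒permutation π-inj

    excB-permuteSigns : excB σ ≡ excBy (signedValue t) π
    excB-permuteSigns = begin
      excB σ
        ≡⟨ count-allFin (λ i → sval σ i ℤ.<? sval σ (absIdx σ i)) ⟩
      ∑[ i < n ] 𝟙 (sval σ i ℤ.<? sval σ (lookup π i))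
        ≡⟨ sum-cong-≗ (λ i → cong₂ (λ x y → 𝟙 (x ℤ.<? y)) (sval-permuteSigns i) (sval-permuteSigns (lookup π i))) ⟩
      ∑[ i < n ] 𝟙 (signedValue t (lookup π i) ℤ.<? signedValue t (lookup π (lookup π i)))
        ≡⟨ sum-permute (λ v → 𝟙 (signedValue t v ℤ.<? signedValue t (lookup π v))) ρ ⟨
      excBy (signedValue t) π
        ∎
      where open ≡-Reasoning

    negB-permuteSigns : negB σ ≡ trueCount (lookup t)
    negB-permuteSigns = begin
      negB σ
        ≡⟨ count-allFin (λ i → sval σ i ℤ.<? ℤ.0ℤ) ⟩
      ∑[ i < n ] 𝟙 (sval σ i ℤ.<? ℤ.0ℤ)
        ≡⟨ sum-cong-≗ (λ i → cong (λ x → 𝟙 (x ℤ.<? ℤ.0ℤ)) (sval-permuteSigns i)) ⟩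
      ∑[ i < n ] 𝟙 (signedValue t (lookup π i) ℤ.<? ℤ.0ℤ)
        ≡⟨ sum-permute (λ v → 𝟙 (signedValue t v ℤ.<? ℤ.0ℤ)) ρ ⟨
      ∑[ v < n ] 𝟙 (signedValue t v ℤ.<? ℤ.0ℤ)
        ≡⟨ sum-cong-≗ (λ v → 𝟙-cong (signedValue t v ℤ.<? ℤ.0ℤ) (lookup t v Bool.≟ true)
                                     (Equivalence.to (signedVal<0⇔ (lookup t v) v))
                                     (Equivalence.from (signedVal<0⇔ (lookup t v) v))) ⟩
      trueCount (lookup t)
        ∎
      where open ≡-Reasoning

-- Coefficients

mono-coeff : (e m a b : ℕ) → mono e m a b ≡ 𝟙 (e ℕ.≟ a) * 𝟙 (m ℕ.≟ b)
mono-coeff e m a b with e ℕ.≟ a | m ℕ.≟ b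
... | yes _ | yes _ = refl
... | yes _ | no _  = refl
... | no _  | yes _ = refl
... | no _  | no _  = refl

sumListP-coeff : (xs : List A) (f : A → Poly) (a b : ℕ) → sumListP xs f a b ≡ sumOver xs (λ x → f x a b)
sumListP-coeff []       f a b = refl
sumListP-coeff (x ∷ xs) f a b = cong (f x a b +_) (sumListP-coeff xs f a b)

sumOver-upTo : (n : ℕ) (g : ℕ → ℕ) → sumOver (upTo n) g ≡ sumBelow n g
sumOver-upTo n g = go n (λ i → i) g
  where
  go : (n : ℕ) (h g : ℕ → ℕ) → sumOver (applyUpTo h n) g ≡ sumBelow n (g ∘ h)
  go zero    h g = refl
  go (suc n) h g = cong (g (h 0) +_) (go n (h ∘ suc) g)

sumToP-coeff : (n : ℕ) (f : ℕ → Poly) (a b : ℕ) → sumToP n f a b ≡ sumBelow (suc n) (λ i → f i a b)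
sumToP-coeff n f a b = trans (sumListP-coeff (upTo (suc n)) f a b) (sumOver-upTo (suc n) (λ i → f i a b))

dBPoly-coeff-by-signs : (n a b : ℕ) → dBPoly n a b ≡
  sumOver (signVectors n) (λ t → 𝟙 (trueCount (lookup t) ℕ.≟ b) * permCount (signedValue t) (lookup t) a)
dBPoly-coeff-by-signs n a b = begin
  dBPoly n a b
    ≡⟨ sumListP-coeff (derangementsB n) (λ σ → mono (excB σ) (negB σ)) a b ⟩
  sumOver (filter isDerangementB? (signedPerms n)) (λ σ → mono (excB σ) (negB σ) a b)
    ≡⟨ sumOver-filter isDerangementB? (signedPerms n) (λ σ → mono (excB σ) (negB σ) a b) ⟩
  sumOver (signedPerms n) H
    ≡⟨ sumOver-concatMap (λ π → map (π ,_) (signVectors n)) (perms n) H ⟩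
  sumOver (perms n) (λ π → sumOver (map (π ,_) (signVectors n)) H)
    ≡⟨ sumOver-cong (perms n) (λ {π} π∈ → trans (sumOver-map (π ,_) (signVectors n) H)
                                               (by-value-signs {π} (sound (perms-isEnumeration n) π∈))) ⟩
  sumOver (perms n) (λ π → sumOver (signVectors n) (λ t → K t π))
    ≡⟨ sumOver-comm (perms n) (signVectors n) (λ π t → K t π) ⟩
  sumOver (signVectors n) (λ t → sumOver (perms n) (K t))
    ≡⟨ sumOver-cong-≗ (signVectors n) (λ t → sumOver-*ˡ (perms n) (𝟙 (trueCount (lookup t) ℕ.≟ b)) _) ⟩
  sumOver (signVectors n) (λ t → 𝟙 (trueCount (lookup t) ℕ.≟ b) * permCount (signedValue t) (lookup t) a)
    ∎
  where
  open ≡-Reasoning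
  H : SignedPerm n → ℕ
  H σ = 𝟙 (isDerangementB? σ) * mono (excB σ) (negB σ) a b
  K : Vec Bool n → Vec (Fin n) n → ℕ
  K t π = 𝟙 (trueCount (lookup t) ℕ.≟ b) * (𝟙 (fixedPointsIn? (lookup t) π) * 𝟙 (excBy (signedValue t) π ℕ.≟ a))
  by-value-signs : {π : Vec (Fin n) n} → IsPermutation π →
                   sumOver (signVectors n) (λ s → H (π , s)) ≡ sumOver (signVectors n) (λ t → K t π)
  by-value-signs {π} π-inj = trans (sumOver-signVectors-permute π π-inj (λ s → H (π , s)))
                                   (sumOver-cong-≗ (signVectors n) summand)
    where
    rotate : (x y z : ℕ) → x * (y * z) ≡ z * (x * y)
    rotate = solve-∀
    summand : ∀ t → H (π , permuteSigns π t) ≡ K t π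
    summand t = begin
      𝟙 (isDerangementB? σ) * mono (excB σ) (negB σ) a b
        ≡⟨ cong₂ _*_ (𝟙-isDerangementB-permuteSigns π t) (mono-coeff (excB σ) (negB σ) a b) ⟩
      𝟙 (fixedPointsIn? (lookup t) π) * (𝟙 (excB σ ℕ.≟ a) * 𝟙 (negB σ ℕ.≟ b))
        ≡⟨ cong₂ (λ e m → 𝟙 (fixedPointsIn? (lookup t) π) * (𝟙 (e ℕ.≟ a) * 𝟙 (m ℕ.≟ b)))
                 (excB-permuteSigns π t π-inj) (negB-permuteSigns π t π-inj) ⟩
      𝟙 (fixedPointsIn? (lookup t) π) * (𝟙 (excBy (signedValue t) π ℕ.≟ a) * 𝟙 (trueCount (lookup t) ℕ.≟ b))
        ≡⟨ rotate (𝟙 (fixedPointsIn? (lookup t) π)) (𝟙 (excBy (signedValue t) π ℕ.≟ a)) (𝟙 (trueCount (lookup t) ℕ.≟ b)) ⟩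
      K t π
        ∎
      where
      σ = π , permuteSigns π t

dBPoly-coeff : (n a b : ℕ) → dBPoly n a b ≡ (n C b) * binomialDerangementSum b n a
dBPoly-coeff n a b = begin
  dBPoly n a b
    ≡⟨ dBPoly-coeff-by-signs n a b ⟩
  sumOver (signVectors n) (λ t → 𝟙 (trueCount (lookup t) ℕ.≟ b) * permCount (signedValue t) (lookup t) a)
    ≡⟨ sumOver-cong-≗ (signVectors n) only-b-signs ⟩
  sumOver (signVectors n) (λ t → binomialDerangementSum b n a * 𝟙 (trueCount (lookup t) ℕ.≟ b))
    ≡⟨ sumOver-*ˡ (signVectors n) (binomialDerangementSum b n a) _ ⟩
  binomialDerangementSum b n a * sumOver (signVectors n) (λ t → 𝟙 (trueCount (lookup t) ℕ.≟ b))
    ≡⟨ cong (binomialDerangementSum b n a *_) (signVectors-with-trueCount n b) ⟩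
  binomialDerangementSum b n a * (n C b)
    ≡⟨ ℕ.*-comm (binomialDerangementSum b n a) (n C b) ⟩
  (n C b) * binomialDerangementSum b n a
    ∎
  where
  open ≡-Reasoning
  only-b-signs : ∀ t → 𝟙 (trueCount (lookup t) ℕ.≟ b) * permCount (signedValue t) (lookup t) a
                     ≡ binomialDerangementSum b n a * 𝟙 (trueCount (lookup t) ℕ.≟ b)
  only-b-signs t with trueCount (lookup t) ℕ.≟ b
  ... | yes refl = trans (ℕ.+-identityʳ _)
                         (trans (permCount≡binomialDerangementSum _ (signedValue t) (signedValue-injective t) (lookup t) refl a)
                                (sym (ℕ.*-identityʳ _)))
  ... | no _     = sym (ℕ.*-zeroʳ (binomialDerangementSum b n a))

dPoly-coeff : (k a b : ℕ) → dPoly k a b ≡ 𝟙 (0 ℕ.≟ b) * derangementCount k a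
dPoly-coeff k a b = begin
  dPoly k a b
    ≡⟨ sumListP-coeff (derangements k) (λ π → mono (exc π) 0) a b ⟩
  sumOver (derangements k) (λ π → mono (exc π) 0 a b)
    ≡⟨ sumOver-cong-≗ (derangements k) (λ π → trans (mono-coeff (exc π) 0 a b) (ℕ.*-comm (𝟙 (exc π ℕ.≟ a)) _)) ⟩
  sumOver (derangements k) (λ π → 𝟙 (0 ℕ.≟ b) * 𝟙 (exc π ℕ.≟ a))
    ≡⟨ sumOver-*ˡ (derangements k) (𝟙 (0 ℕ.≟ b)) (λ π → 𝟙 (exc π ℕ.≟ a)) ⟩
  𝟙 (0 ℕ.≟ b) * sumOver (derangements k) (λ π → 𝟙 (exc π ℕ.≟ a))
    ≡⟨ cong (𝟙 (0 ℕ.≟ b) *_) (sumOver-filter isDerangement? (perms k) (λ π → 𝟙 (exc π ℕ.≟ a))) ⟩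
  𝟙 (0 ℕ.≟ b) * derangementCount k a
    ∎
  where open ≡-Reasoning

dPoly-⊗-qPow : (k i a b : ℕ) → (dPoly k ⊗ qPow i) a b ≡ 𝟙 (i ℕ.≟ b) * derangementCount k a
dPoly-⊗-qPow k i a b = begin
  (dPoly k ⊗ qPow i) a b
    ≡⟨ sumOver-upTo (suc a) (λ a′ → sumTo b (λ b′ → dPoly k a′ b′ * qPow i (a ∸ a′) (b ∸ b′))) ⟩
  sumBelow (suc a) (λ a′ → sumTo b (λ b′ → dPoly k a′ b′ * qPow i (a ∸ a′) (b ∸ b′)))
    ≡⟨ sumBelow-cong (suc a) only-q⁰-of-dPoly ⟩
  sumBelow (suc a) (λ a′ → dPoly k a′ 0 * qPow i (a ∸ a′) b)
    ≡⟨ sumBelow-last a (λ a′ → dPoly k a′ 0 * qPow i (a ∸ a′) b) only-x⁰-of-qPow ⟩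
  dPoly k a 0 * qPow i (a ∸ a) b
    ≡⟨ cong₂ (λ d x → d * mono 0 i x b) (trans (dPoly-coeff k a 0) (ℕ.*-identityˡ _)) (ℕ.n∸n≡0 a) ⟩
  derangementCount k a * mono 0 i 0 b
    ≡⟨ cong (derangementCount k a *_) (trans (mono-coeff 0 i 0 b) (ℕ.*-identityˡ _)) ⟩
  derangementCount k a * 𝟙 (i ℕ.≟ b)
    ≡⟨ ℕ.*-comm (derangementCount k a) _ ⟩
  𝟙 (i ℕ.≟ b) * derangementCount k a
    ∎
  where
  open ≡-Reasoning
  only-q⁰-of-dPoly : ∀ a′ → sumTo b (λ b′ → dPoly k a′ b′ * qPow i (a ∸ a′) (b ∸ b′)) ≡ dPoly k a′ 0 * qPow i (a ∸ a′) b
  only-q⁰-of-dPoly a′ = trans (sumOver-upTo (suc b) term) (sumBelow-head b term q-positive)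
    where
    term : ℕ → ℕ
    term b′ = dPoly k a′ b′ * qPow i (a ∸ a′) (b ∸ b′)
    q-positive : ∀ b′ → term (suc b′) ≡ 0
    q-positive b′ = cong (_* qPow i (a ∸ a′) (b ∸ suc b′)) (dPoly-coeff k a′ (suc b′))
  only-x⁰-of-qPow : ∀ a′ → a′ < a → dPoly k a′ 0 * qPow i (a ∸ a′) b ≡ 0
  only-x⁰-of-qPow a′ a′<a = begin
    dPoly k a′ 0 * qPow i (a ∸ a′) b                    ≡⟨ cong (dPoly k a′ 0 *_) (mono-coeff 0 i (a ∸ a′) b) ⟩
    dPoly k a′ 0 * (𝟙 (0 ℕ.≟ a ∸ a′) * 𝟙 (i ℕ.≟ b))    ≡⟨ cong (λ e → dPoly k a′ 0 * (e * _)) x-positive ⟩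
    dPoly k a′ 0 * 0                                    ≡⟨ ℕ.*-zeroʳ (dPoly k a′ 0) ⟩
    0                                                   ∎
    where
    x-positive : 𝟙 (0 ℕ.≟ a ∸ a′) ≡ 0
    x-positive = 𝟙-no (0 ℕ.≟ a ∸ a′) (ℕ.m>n⇒m∸n≢0 a′<a ∘ sym)

rhs-coeff : (n a b : ℕ) →
  sumToP n (λ i → sumToP i (λ j → ((n C i) * (i C j)) ⊙ (dPoly (n ∸ j) ⊗ qPow i))) a b
  ≡ (n C b) * binomialDerangementSum b n a
rhs-coeff n a b = begin
  sumToP n (λ i → sumToP i (λ j → ((n C i) * (i C j)) ⊙ (dPoly (n ∸ j) ⊗ qPow i))) a b
    ≡⟨ sumToP-coeff n (λ i → sumToP i (λ j → ((n C i) * (i C j)) ⊙ (dPoly (n ∸ j) ⊗ qPow i))) a b ⟩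
  sumBelow (suc n) (λ i → sumToP i (λ j → ((n C i) * (i C j)) ⊙ (dPoly (n ∸ j) ⊗ qPow i)) a b)
    ≡⟨ sumBelow-cong (suc n) inner-sum ⟩
  sumBelow (suc n) (λ i → 𝟙 (i ℕ.≟ b) * ((n C i) * binomialDerangementSum i n a))
    ≡⟨ sumBelow-delta (suc n) b (λ i → (n C i) * binomialDerangementSum i n a) ⟩
  𝟙 (b <? suc n) * ((n C b) * binomialDerangementSum b n a)
    ≡⟨ vanishes-unless-b≤n ⟩
  (n C b) * binomialDerangementSum b n a
    ∎
  where
  open ≡-Reasoning
  rearrange : (x y z w : ℕ) → (x * y) * (z * w) ≡ z * (x * (y * w))
  rearrange = solve-∀
  inner-sum : ∀ i → sumToP i (λ j → ((n C i) * (i C j)) ⊙ (dPoly (n ∸ j) ⊗ qPow i)) a b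
                  ≡ 𝟙 (i ℕ.≟ b) * ((n C i) * binomialDerangementSum i n a)
  inner-sum i = begin
    sumToP i (λ j → ((n C i) * (i C j)) ⊙ (dPoly (n ∸ j) ⊗ qPow i)) a b
      ≡⟨ sumToP-coeff i (λ j → ((n C i) * (i C j)) ⊙ (dPoly (n ∸ j) ⊗ qPow i)) a b ⟩
    sumBelow (suc i) (λ j → (n C i) * (i C j) * (dPoly (n ∸ j) ⊗ qPow i) a b)
      ≡⟨ sumBelow-cong (suc i) (λ j → trans (cong ((n C i) * (i C j) *_) (dPoly-⊗-qPow (n ∸ j) i a b))
                                            (rearrange (n C i) (i C j) (𝟙 (i ℕ.≟ b)) (derangementCount (n ∸ j) a))) ⟩
    sumBelow (suc i) (λ j → 𝟙 (i ℕ.≟ b) * ((n C i) * ((i C j) * derangementCount (n ∸ j) a)))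
      ≡⟨ sumBelow-*ˡ (suc i) (𝟙 (i ℕ.≟ b)) (λ j → (n C i) * ((i C j) * derangementCount (n ∸ j) a)) ⟩
    𝟙 (i ℕ.≟ b) * sumBelow (suc i) (λ j → (n C i) * ((i C j) * derangementCount (n ∸ j) a))
      ≡⟨ cong (𝟙 (i ℕ.≟ b) *_) (sumBelow-*ˡ (suc i) (n C i) (λ j → (i C j) * derangementCount (n ∸ j) a)) ⟩
    𝟙 (i ℕ.≟ b) * ((n C i) * binomialDerangementSum i n a)
      ∎
  vanishes-unless-b≤n : 𝟙 (b <? suc n) * ((n C b) * binomialDerangementSum b n a)
                      ≡ (n C b) * binomialDerangementSum b n a
  vanishes-unless-b≤n with b <? suc n
  ... | yes _   = ℕ.+-identityʳ _
  ... | no b≮1+n = cong (_* binomialDerangementSum b n a) (sym (k>n⇒nCk≡0 (ℕ.≰⇒> (b≮1+n ∘ s≤s))))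

mainTheorem12 : (n : ℕ) →
    dBPoly n ≋ sumToP n (λ i → sumToP i (λ j → ((n C i) * (i C j)) ⊙ (dPoly (n ∸ j) ⊗ qPow i)))
mainTheorem12 n a b = trans (dBPoly-coeff n a b) (sym (rhs-coeff n a b))
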